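{- Let $\ell PST_\lambda$ be the probabilistic linear $\lambda$-calculus described in the context. For every type $A$ and every term $e$ with $\vdash e : A$ (closed and typable in the empty context), there is a unique subdistribution $\mathscr{E}$ over closed values of type $A$ such that $e \Downarrow \mathscr{E}$.
   Context: Terms and values of $\ell PST_\lambda$: $e,f ::= v \mid ef \mid \mathtt{if}\ e\ \mathtt{then}\ e\ \mathtt{else}\ e \mid \mathtt{let}\ e\ \mathtt{be}\ \langle x,y\rangle\ \mathtt{in}\ e \mid \Omega \mid e\oplus e$; $v,w ::= x \mid \mathtt{tt} \mid \mathtt{ff} \mid \lambda x.e \mid \langle v,w\rangle$. Types: $A,B ::= \mathtt{bool} \mid A\multimap B \mid A\otimes B$. Typing judgments $\Gamma\vdash e:A$ ($\Gamma$ a finite assignment of types to variables; $\Gamma,\Delta$ denotes a disjoint union) are given by the linear rules: $x:A\vdash x:A$; $\vdash \mathtt{tt}:\mathtt{bool}$ and $\vdash\mathtt{ff}:\mathtt{bool}$; $\Gamma\vdash\Omega:A$ for any $\Gamma,A$; if $\Gamma,x:A\vdash e:B$ then $\Gamma\vdash\lambda x.e:A\multimap B$; if $\Gamma\vdash e:A\multimap B$ and $\Delta\vdash f:A$ then $\Gamma,\Delta\vdash ef:B$; if $\Gamma\vdash v:A$ and $\Delta\vdash w:B$ then $\Gamma,\Delta\vdash\langle v,w\rangle:A\otimes B$; if $\Gamma,x:X,y:Y\vdash e:A$ and $\Delta\vdash f:X\otimes Y$ then $\Gamma,\Delta\vdash \mathtt{let}\ f\ \mathtt{be}\ \langle x,y\rangle\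 \mathtt{in}\ e:A$; if $\Gamma\vdash e:\mathtt{bool}$, $\Delta\vdash f:A$, $\Delta\vdash g:A$ then $\Gamma,\Delta\vdash\mathtt{if}\ e\ \mathtt{then}\ f\ \mathtt{else}\ g:A$; if $\Gamma\vdash e:A$ and $\Gamma\vdash f:A$ then $\Gamma\vdash e\oplus f:A$. A subdistribution over values is a function $\mathscr{E}$ from closed values to $[0,1]$ with finite support and $\sum_v\mathscr{E}(v)\le 1$; $\{v^1\}$ is the point distribution and $\emptyset$ the zero one. Big-step call-by-value evaluation $e\Downarrow\mathscr{E}$ (closed terms to subdistributions) is defined by: $v\Downarrow\{v^1\}$; $\Omega\Downarrow\emptyset$; if $e\Downarrow\mathscr{E}$, $f\Downarrow\mathscr{F}$ and $s\{w/x\}\Downarrow\mathscr{G}_{\lambda x.s,w}$ for every $\lambda x.s$ in the support of $\mathscr{E}$ and $w$ in the support of $\mathscr{F}$, then $ef\Downarrow\sum \mathscr{E}(\lambda x.s)\mathscr{F}(w)\mathscr{G}_{\lambda x.s,w}$; if $e\Downarrow\mathscr{E}$, $f\Downarrow\mathscr{F}$, $g\Downarrow\mathscr{G}$ then $\mathtt{if}\ e\ \mathtt{then}\ f\ \mathtt{else}\ g\Downarrow\mathscr{E}(\mathtt{tt})\mathscr{F}+\mathscr{E}(\mathtt{ff})\mathscr{G}$; if $e\Downarrow\mathscr{E}$ and $f\Downarrow\mathscr{F}$ then $e\oplus f\Downarrow\frac12\mathscr{E}+\frac12\mathscr{F}$; if $e\Downarrow\mathscr{E}$ and $f\{v/x,w/y\}\Downarrow\mathscr{G}_{v,w}$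 for each $\langle v,w\rangle$ in the support of $\mathscr{E}$, then $\mathtt{let}\ e\ \mathtt{be}\ \langle x,y\rangle\ \mathtt{in}\ f\Downarrow\sum\mathscr{E}(\langle v,w\rangle)\mathscr{G}_{v,w}$. -}

module Defs where

open import Data.Nat using (ℕ; _≟_)
open import Data.Bool using (Bool; true; false; if_then_else_)
open import Data.Product using (_×_; _,_; proj₁)
open import Data.List using (List; []; _∷_; _++_; map; foldr)
open import Data.List.Relation.Unary.All using (All)
open import Data.List.Relation.Unary.Unique.Propositional using (Unique)
open import Data.List.Relation.Binary.Disjoint.Propositional using (Disjoint)
open import Data.List.Relation.Binary.Permutation.Propositional using (_↭_)
open import Data.List.Membership.Propositional using (_∉_)
open import Data.Rational using (ℚ; 0ℚ; 1ℚ; ½; _+_; _*_; _≤_; _<_)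
open import Relation.Binary.PropositionalEquality using (_≡_; _≢_)
open import Relation.Nullary using (does)

Var : Set
Var = ℕ

mutual
  data Val : Set where
    var  : Var → Val
    tt   : Val
    ff   : Val
    lam  : Var → Term → Val
    pair : Val → Val → Val

  data Term : Set where
    val   : Val → Term
    app   : Term → Term → Term
    ifte  : Term → Term → Term → Term
    letp  : Term → Var → Var → Term → Term   -- letp e x y f = let e be ⟨x,y⟩ in f
    Ω     : Term
    _⊕_   : Term → Term → Term

mutual
  fvV : Val → List Var
  fvV (var x)    = x ∷ []
  fvV tt         = []
  fvV ff         = []
  fvV (lam x e)  = remove x (fv e)
  fvV (pair v w) = fvV v ++ fvV w

  fv : Term → List Var
  fv (val v)      = fvV v
  fv (app e f)    = fv e ++ fv f
  fv (ifte e f g) = fv e ++ fv f ++ fv g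
  fv (letp e x y f) = fv e ++ remove x (remove y (fv f))
  fv Ω            = []
  fv (e ⊕ f)      = fv e ++ fv f

  remove : Var → List Var → List Var
  remove x []       = []
  remove x (y ∷ ys) = if does (x ≟ y) then remove x ys else y ∷ remove x ys

ClosedV : Val → Set
ClosedV v = fvV v ≡ []

-- substitution e{w/x}.  It is only ever used with closed w, so no
-- capture can occur and no renaming is needed.
mutual
  substV : Val → Var → Val → Val
  substV (var y) x w    = if does (x ≟ y) then w else var y
  substV tt x w         = tt
  substV ff x w         = ff
  substV (lam y e) x w  = if does (x ≟ y) then lam y e else lam y (subst e x w)
  substV (pair u v) x w = pair (substV u x w) (substV v x w)

  subst : Term → Var → Val → Term
  subst (val v) x w        = val (substV v x w)
  subst (app e f) x w      = app (subst e x w) (subst f x w)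
  subst (ifte e f g) x w   = ifte (subst e x w) (subst f x w) (subst g x w)
  subst (letp e y z f) x w =
    letp (subst e x w) y z
         (if does (x ≟ y) then f else if does (x ≟ z) then f else subst f x w)
  subst Ω x w              = Ω
  subst (e ⊕ f) x w        = subst e x w ⊕ subst f x w

data Ty : Set where
  bool : Ty
  _⊸_  : Ty → Ty → Ty
  _⊗_  : Ty → Ty → Ty

-- a context is a finite assignment of types to variables, given as a list
-- (taken up to permutation, with pairwise distinct variables)
Ctx : Set
Ctx = List (Var × Ty)

dom : Ctx → List Var
dom Γ = map proj₁ Γ

Split : Ctx → Ctx → Ctx → Set
Split Γ Γ₁ Γ₂ = Disjoint (dom Γ₁) (dom Γ₂) × (Γ ↭ (Γ₁ ++ Γ₂))

infix 4 _⊢_∶_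
data _⊢_∶_ : Ctx → Term → Ty → Set where
  ty-var  : ∀ {x A} → ((x , A) ∷ []) ⊢ val (var x) ∶ A
  ty-tt   : [] ⊢ val tt ∶ bool
  ty-ff   : [] ⊢ val ff ∶ bool
  ty-Ω    : ∀ {Γ A} → Unique (dom Γ) → Γ ⊢ Ω ∶ A
  ty-lam  : ∀ {Γ x e A B} → x ∉ dom Γ → ((x , A) ∷ Γ) ⊢ e ∶ B →
            Γ ⊢ val (lam x e) ∶ (A ⊸ B)
  ty-app  : ∀ {Γ Γ₁ Γ₂ e f A B} → Γ₁ ⊢ e ∶ (A ⊸ B) → Γ₂ ⊢ f ∶ A →
            Split Γ Γ₁ Γ₂ → Γ ⊢ app e f ∶ B
  ty-pair : ∀ {Γ Γ₁ Γ₂ v w A B} → Γ₁ ⊢ val v ∶ A → Γ₂ ⊢ val w ∶ B →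
            Split Γ Γ₁ Γ₂ → Γ ⊢ val (pair v w) ∶ (A ⊗ B)
  ty-let  : ∀ {Γ Γ₁ Γ₂ x y X Y e f A} →
            x ≢ y → x ∉ dom Γ₁ → y ∉ dom Γ₁ →
            ((x , X) ∷ (y , Y) ∷ Γ₁) ⊢ e ∶ A → Γ₂ ⊢ f ∶ (X ⊗ Y) →
            Split Γ Γ₁ Γ₂ → Γ ⊢ letp f x y e ∶ A
  ty-if   : ∀ {Γ Γ₁ Γ₂ e f g A} → Γ₁ ⊢ e ∶ bool → Γ₂ ⊢ f ∶ A → Γ₂ ⊢ g ∶ A →
            Split Γ Γ₁ Γ₂ → Γ ⊢ ifte e f g ∶ A
  ty-⊕    : ∀ {Γ e f A} → Γ ⊢ e ∶ A → Γ ⊢ f ∶ A → Γ ⊢ (e ⊕ f) ∶ A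

-- Subdistributions over closed values.
-- mass v is the probability of v; it is 0 outside the finite list supp,
-- supp is duplicate-free and consists of closed values, and the total
-- mass is ≤ 1.  (The support proper is {v | 0 < mass v}.)

sumℚ : List ℚ → ℚ
sumℚ = foldr _+_ 0ℚ

record SubDist : Set where
  field
    mass        : Val → ℚ
    supp        : List Val
    supp-unique : Unique supp
    supp-closed : All ClosedV supp
    mass-nonneg : ∀ v → 0ℚ ≤ mass v
    mass-out    : ∀ v → v ∉ supp → mass v ≡ 0ℚ
    mass-total  : sumℚ (map mass supp) ≤ 1ℚ
open SubDist public

_≈D_ : SubDist → SubDist → Set
E ≈D F = ∀ v → mass E v ≡ mass F v

appMass : SubDist → SubDist → (Val → Val → SubDist) → Val → ℚ
appMass E F G u = sumℚ (map (λ v → sumℚ (map (term v) (supp F))) (supp E))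
  where
  term : Val → Val → ℚ
  term (lam x s) w = mass E (lam x s) * mass F w * mass (G (lam x s) w) u
  term _         w = 0ℚ

letMass : SubDist → (Val → Val → SubDist) → Val → ℚ
letMass E G u = sumℚ (map term (supp E))
  where
  term : Val → ℚ
  term (pair v w) = mass E (pair v w) * mass (G v w) u
  term _          = 0ℚ

infix 4 _⇓_
data _⇓_ : Term → SubDist → Set where
  ev-val : ∀ {v E} → mass E v ≡ 1ℚ → (∀ u → u ≢ v → mass E u ≡ 0ℚ) →
           val v ⇓ E
  ev-Ω   : ∀ {E} → (∀ u → mass E u ≡ 0ℚ) → Ω ⇓ E
  ev-app : ∀ {e f E F H} (G : Val → Val → SubDist) →
           e ⇓ E → f ⇓ F →
           (∀ x s w → 0ℚ < mass E (lam x s) → 0ℚ < mass F w →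
              subst s x w ⇓ G (lam x s) w) →
           (∀ u → mass H u ≡ appMass E F G u) →
           app e f ⇓ H
  ev-if  : ∀ {e f g E F G H} → e ⇓ E → f ⇓ F → g ⇓ G →
           (∀ u → mass H u ≡ mass E tt * mass F u + mass E ff * mass G u) →
           ifte e f g ⇓ H
  ev-⊕   : ∀ {e f E F H} → e ⇓ E → f ⇓ F →
           (∀ u → mass H u ≡ ½ * mass E u + ½ * mass F u) →
           (e ⊕ f) ⇓ H
  ev-let : ∀ {e x y f E H} (G : Val → Val → SubDist) →
           e ⇓ E →
           (∀ v w → 0ℚ < mass E (pair v w) →
              subst (subst f x v) y w ⇓ G v w) →
           (∀ u → mass H u ≡ letMass E G u) →
           letp e x y f ⇓ H

OfType : Ty → SubDist → Set
OfType A E = ∀ v → 0ℚ < mass E v → [] ⊢ val v ∶ A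

-- Uniqueness is by induction on evaluation derivations: every rule computes the mass of the
-- result from the masses of its premisses, and the premisses about substituted bodies are only
-- demanded where the corresponding masses are positive, so the bodies left unconstrained are
-- weighted by zero.
--
-- Existence: the application and let rules are monadic binds of subdistributions, and the result
-- is built by induction on a size in which an abstraction weighs as much as its body.  By
-- linearity the substituted variable occurs in only one component of every split, so
-- substituting a closed value w adds at most the size of w.  Hence a term only produces values no
-- larger than itself, and the body of each redex it meets is strictly smaller than the term.

module Submission where

open import Defs
open import Algebra.Bundles using (CommutativeMonoid)
import Algebra.Properties.CommutativeSemigroup as CommSemigroupProperties
open import Data.Bool using (if_then_else_)
open import Data.Empty using (⊥-elim)
open import Data.List using (List; []; _∷_; _++_; map; concatMap; deduplicate)
open import Data.List.Properties using (++-conicalˡ; ++-conicalʳ)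
open import Data.List.Membership.DecPropositional using () renaming (_∈?_ to member?)
open import Data.List.Membership.Propositional using (_∈_; _∉_)
open import Data.List.Membership.Propositional.Properties
  using (∈-∃++; ∈-++⁺ˡ; ∈-++⁺ʳ; ∈-++⁻; ∈-map⁺; ∈-concatMap⁺; ∈-deduplicate⁺)
open import Data.List.Relation.Binary.Permutation.Propositional as ↭
  using (_↭_; ↭-sym; ↭-trans; ↭⇒↭ₛ)
open import Data.List.Relation.Binary.Permutation.Propositional.Properties as ↭
  using (∈-resp-↭; shift; drop-∷; ↭-singleton-inv; ↭-empty-inv; ¬x∷xs↭[])
open import Data.List.Relation.Binary.Subset.Propositional using (_⊆_)
open import Data.List.Relation.Binary.Subset.Propositional.Properties as ⊆
  using (⊆-trans; ⊆-reflexive-↭; xs⊆xs++ys; xs⊆ys++xs)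
open import Data.List.Relation.Unary.All as All using (All; []; _∷_)
open import Data.List.Relation.Unary.All.Properties as All using ()
open import Data.List.Relation.Unary.Any as Any using (here; there)
open import Data.List.Relation.Unary.Unique.Propositional using (Unique; []; _∷_)
open import Data.Nat as ℕ using (ℕ; zero; suc; _⊔_; z≤n; s≤s)
  renaming (_+_ to _+ₙ_; _≤_ to _≤ₙ_; _<_ to _<ₙ_)
import Data.Nat.Properties as ℕₚ
open import Data.Product as Product using (Σ; ∃; _×_; _,_; proj₁; proj₂)
open import Data.Rational using (ℚ; 0ℚ; 1ℚ; ½; _+_; _*_; _≤_; _<_; nonNegative)
open import Data.Rational.Properties
open import Data.Sum using (_⊎_; inj₁; inj₂)
open import Function using (_∘′_; case_of_)
open import Relation.Binary.Definitions using (DecidableEquality)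
open import Relation.Binary.PropositionalEquality
  using (_≡_; _≢_; refl; sym; trans; cong; cong₂; setoid; module ≡-Reasoning)
  renaming (subst to transport)
open import Relation.Nullary using (Dec; yes; no; ¬_; does)
open import Relation.Nullary.Decidable using (_×-dec_; dec-true; dec-false)
open import Relation.Unary using (Decidable)

open import Data.List.Relation.Binary.Permutation.Setoid.Properties (setoid Var)
  using (Unique-resp-↭)

module ℕ+ = CommSemigroupProperties ℕₚ.+-commutativeSemigroup
module ℚ+ = CommSemigroupProperties (CommutativeMonoid.commutativeSemigroup +-0-commutativeMonoid)

infix 4 _≟ᵛ_ _≟ᵗ_

mutual
  _≟ᵛ_ : DecidableEquality Val
  var x ≟ᵛ var y with x ℕ.≟ y
  ... | yes refl = yes refl
  ... | no x≢y = no λ { refl → x≢y refl }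
  tt ≟ᵛ tt = yes refl
  ff ≟ᵛ ff = yes refl
  lam x e ≟ᵛ lam y f with x ℕ.≟ y | e ≟ᵗ f
  ... | yes refl | yes refl = yes refl
  ... | no x≢y   | _        = no λ { refl → x≢y refl }
  ... | _        | no e≢f   = no λ { refl → e≢f refl }
  pair v w ≟ᵛ pair v′ w′ with v ≟ᵛ v′ | w ≟ᵛ w′
  ... | yes refl | yes refl = yes refl
  ... | no v≢v′  | _        = no λ { refl → v≢v′ refl }
  ... | _        | no w≢w′  = no λ { refl → w≢w′ refl }
  var _    ≟ᵛ tt       = no λ ()
  var _    ≟ᵛ ff       = no λ ()
  var _    ≟ᵛ lam _ _  = no λ ()
  var _    ≟ᵛ pair _ _ = no λ ()
  tt       ≟ᵛ var _    = no λ ()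
  tt       ≟ᵛ ff       = no λ ()
  tt       ≟ᵛ lam _ _  = no λ ()
  tt       ≟ᵛ pair _ _ = no λ ()
  ff       ≟ᵛ var _    = no λ ()
  ff       ≟ᵛ tt       = no λ ()
  ff       ≟ᵛ lam _ _  = no λ ()
  ff       ≟ᵛ pair _ _ = no λ ()
  lam _ _  ≟ᵛ var _    = no λ ()
  lam _ _  ≟ᵛ tt       = no λ ()
  lam _ _  ≟ᵛ ff       = no λ ()
  lam _ _  ≟ᵛ pair _ _ = no λ ()
  pair _ _ ≟ᵛ var _    = no λ ()
  pair _ _ ≟ᵛ tt       = no λ ()
  pair _ _ ≟ᵛ ff       = no λ ()
  pair _ _ ≟ᵛ lam _ _  = no λ ()

  _≟ᵗ_ : DecidableEquality Term
  val v ≟ᵗ val w with v ≟ᵛ w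
  ... | yes refl = yes refl
  ... | no v≢w   = no λ { refl → v≢w refl }
  app e f ≟ᵗ app e′ f′ with e ≟ᵗ e′ | f ≟ᵗ f′
  ... | yes refl | yes refl = yes refl
  ... | no ≢₁    | _        = no λ { refl → ≢₁ refl }
  ... | _        | no ≢₂    = no λ { refl → ≢₂ refl }
  ifte e f g ≟ᵗ ifte e′ f′ g′ with e ≟ᵗ e′ | f ≟ᵗ f′ | g ≟ᵗ g′
  ... | yes refl | yes refl | yes refl = yes refl
  ... | no ≢₁    | _        | _        = no λ { refl → ≢₁ refl }
  ... | _        | no ≢₂    | _        = no λ { refl → ≢₂ refl }
  ... | _        | _        | no ≢₃    = no λ { refl → ≢₃ refl }
  letp e x y f ≟ᵗ letp e′ x′ y′ f′
    with e ≟ᵗ e′ | x ℕ.≟ x′ | y ℕ.≟ y′ | f ≟ᵗ f′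
  ... | yes refl | yes refl | yes refl | yes refl = yes refl
  ... | no ≢₁    | _        | _        | _        = no λ { refl → ≢₁ refl }
  ... | _        | no ≢₂    | _        | _        = no λ { refl → ≢₂ refl }
  ... | _        | _        | no ≢₃    | _        = no λ { refl → ≢₃ refl }
  ... | _        | _        | _        | no ≢₄    = no λ { refl → ≢₄ refl }
  Ω ≟ᵗ Ω = yes refl
  (e ⊕ f) ≟ᵗ (e′ ⊕ f′) with e ≟ᵗ e′ | f ≟ᵗ f′
  ... | yes refl | yes refl = yes refl
  ... | no ≢₁    | _        = no λ { refl → ≢₁ refl }
  ... | _        | no ≢₂    = no λ { refl → ≢₂ refl }
  val _        ≟ᵗ app _ _      = no λ ()
  val _        ≟ᵗ ifte _ _ _   = no λ ()
  val _        ≟ᵗ letp _ _ _ _ = no λ ()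
  val _        ≟ᵗ Ω            = no λ ()
  val _        ≟ᵗ (_ ⊕ _)      = no λ ()
  app _ _      ≟ᵗ val _        = no λ ()
  app _ _      ≟ᵗ ifte _ _ _   = no λ ()
  app _ _      ≟ᵗ letp _ _ _ _ = no λ ()
  app _ _      ≟ᵗ Ω            = no λ ()
  app _ _      ≟ᵗ (_ ⊕ _)      = no λ ()
  ifte _ _ _   ≟ᵗ val _        = no λ ()
  ifte _ _ _   ≟ᵗ app _ _      = no λ ()
  ifte _ _ _   ≟ᵗ letp _ _ _ _ = no λ ()
  ifte _ _ _   ≟ᵗ Ω            = no λ ()
  ifte _ _ _   ≟ᵗ (_ ⊕ _)      = no λ ()
  letp _ _ _ _ ≟ᵗ val _        = no λ ()
  letp _ _ _ _ ≟ᵗ app _ _      = no λ ()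
  letp _ _ _ _ ≟ᵗ ifte _ _ _   = no λ ()
  letp _ _ _ _ ≟ᵗ Ω            = no λ ()
  letp _ _ _ _ ≟ᵗ (_ ⊕ _)      = no λ ()
  Ω            ≟ᵗ val _        = no λ ()
  Ω            ≟ᵗ app _ _      = no λ ()
  Ω            ≟ᵗ ifte _ _ _   = no λ ()
  Ω            ≟ᵗ letp _ _ _ _ = no λ ()
  Ω            ≟ᵗ (_ ⊕ _)      = no λ ()
  (_ ⊕ _)      ≟ᵗ val _        = no λ ()
  (_ ⊕ _)      ≟ᵗ app _ _      = no λ ()
  (_ ⊕ _)      ≟ᵗ ifte _ _ _   = no λ ()
  (_ ⊕ _)      ≟ᵗ letp _ _ _ _ = no λ ()
  (_ ⊕ _)      ≟ᵗ Ω            = no λ ()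

*-nonneg : ∀ {p q} → 0ℚ ≤ p → 0ℚ ≤ q → 0ℚ ≤ p * q
*-nonneg {p} {q} 0≤p 0≤q =
  nonNegative⁻¹ (p * q) {{nonNeg*nonNeg⇒nonNeg p {{nonNegative 0≤p}} q {{nonNegative 0≤q}}}}

*-monoʳ-≤-nonneg : ∀ {r p q} → 0ℚ ≤ r → p ≤ q → r * p ≤ r * q
*-monoʳ-≤-nonneg {r} 0≤r = *-monoˡ-≤-nonNeg r {{nonNegative 0≤r}}

nonneg⇒≡0⊎pos : ∀ {p} → 0ℚ ≤ p → p ≡ 0ℚ ⊎ 0ℚ < p
nonneg⇒≡0⊎pos {p} 0≤p with 0ℚ <? p
... | yes 0<p = inj₂ 0<p
... | no  0≮p = inj₁ (≤-antisym (≮⇒≥ 0≮p) 0≤p)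

0≮0 : ¬ 0ℚ < 0ℚ
0≮0 = <-irrefl refl

+-pos⁻ : ∀ {p q} → 0ℚ ≤ p → 0ℚ ≤ q → 0ℚ < p + q → 0ℚ < p ⊎ 0ℚ < q
+-pos⁻ 0≤p 0≤q 0<p+q with nonneg⇒≡0⊎pos 0≤p | nonneg⇒≡0⊎pos 0≤q
... | inj₂ 0<p  | _         = inj₁ 0<p
... | inj₁ _    | inj₂ 0<q  = inj₂ 0<q
... | inj₁ refl | inj₁ refl = ⊥-elim (0≮0 0<p+q)

*-pos⁻ : ∀ {p q} → 0ℚ ≤ p → 0ℚ ≤ q → 0ℚ < p * q → 0ℚ < p × 0ℚ < q
*-pos⁻ {p} {q} 0≤p 0≤q 0<pq with nonneg⇒≡0⊎pos 0≤p | nonneg⇒≡0⊎pos 0≤q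
... | inj₂ 0<p  | inj₂ 0<q  = 0<p , 0<q
... | inj₁ refl | _         = ⊥-elim (0≮0 (transport (0ℚ <_) (*-zeroˡ q) 0<pq))
... | _         | inj₁ refl = ⊥-elim (0≮0 (transport (0ℚ <_) (*-zeroʳ p) 0<pq))

∈⇒↭∷ : ∀ {A : Set} {x : A} {xs} → x ∈ xs → ∃ λ ys → xs ↭ x ∷ ys
∈⇒↭∷ {x = x} x∈xs with ys , zs , refl ← ∈-∃++ x∈xs = _ , shift x ys zs

∑ : ∀ {A : Set} → List A → (A → ℚ) → ℚ
∑ xs f = sumℚ (map f xs)

module _ {A : Set} where

  ∑-cong : ∀ xs {f g : A → ℚ} → (∀ {x} → x ∈ xs → f x ≡ g x) → ∑ xs f ≡ ∑ xs g
  ∑-cong []       f≡g = refl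
  ∑-cong (x ∷ xs) f≡g = cong₂ _+_ (f≡g (here refl)) (∑-cong xs (f≡g ∘′ there))

  ∑-zero : ∀ xs {f : A → ℚ} → (∀ {x} → x ∈ xs → f x ≡ 0ℚ) → ∑ xs f ≡ 0ℚ
  ∑-zero []       f≡0 = refl
  ∑-zero (x ∷ xs) f≡0 rewrite f≡0 (here refl) | ∑-zero xs (f≡0 ∘′ there) = refl

  ∑-mono-≤ : ∀ xs {f g : A → ℚ} → (∀ {x} → x ∈ xs → f x ≤ g x) → ∑ xs f ≤ ∑ xs g
  ∑-mono-≤ []       f≤g = ≤-refl
  ∑-mono-≤ (x ∷ xs) f≤g = +-mono-≤ (f≤g (here refl)) (∑-mono-≤ xs (f≤g ∘′ there))

  ∑-nonneg : ∀ xs {f : A → ℚ} → (∀ x → 0ℚ ≤ f x) → 0ℚ ≤ ∑ xs f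
  ∑-nonneg xs {f} 0≤f =
    transport (_≤ ∑ xs f) (∑-zero xs {λ _ → 0ℚ} λ _ → refl) (∑-mono-≤ xs λ {x} _ → 0≤f x)

  ∑-+ : ∀ xs (f g : A → ℚ) → ∑ xs (λ x → f x + g x) ≡ ∑ xs f + ∑ xs g
  ∑-+ []       f g = refl
  ∑-+ (x ∷ xs) f g rewrite ∑-+ xs f g = ℚ+.interchange (f x) (g x) (∑ xs f) (∑ xs g)

  ∑-*ˡ : ∀ xs c (f : A → ℚ) → ∑ xs (λ x → c * f x) ≡ c * ∑ xs f
  ∑-*ˡ []       c f = sym (*-zeroʳ c)
  ∑-*ˡ (x ∷ xs) c f rewrite ∑-*ˡ xs c f = sym (*-distribˡ-+ c (f x) (∑ xs f))

  ∑-↭ : ∀ {xs ys} (f : A → ℚ) → xs ↭ ys → ∑ xs f ≡ ∑ ys f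
  ∑-↭ f ↭.refl         = refl
  ∑-↭ f (↭.prep x p)   = cong (f x +_) (∑-↭ f p)
  ∑-↭ f (↭.swap x y p) =
    trans (cong (λ s → f x + (f y + s)) (∑-↭ f p)) (ℚ+.x∙yz≈y∙xz (f x) (f y) _)
  ∑-↭ f (↭.trans p q)  = trans (∑-↭ f p) (∑-↭ f q)

  ∑-pos⁻ : ∀ xs {f : A → ℚ} → (∀ x → 0ℚ ≤ f x) → 0ℚ < ∑ xs f → ∃ λ x → 0ℚ < f x
  ∑-pos⁻ []       0≤f 0<∑ = ⊥-elim (0≮0 0<∑)
  ∑-pos⁻ (x ∷ xs) 0≤f 0<∑ with +-pos⁻ (0≤f x) (∑-nonneg xs 0≤f) 0<∑
  ... | inj₁ 0<fx = x , 0<fx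
  ... | inj₂ 0<∑xs = ∑-pos⁻ xs 0≤f 0<∑xs

∑-comm : ∀ {A B : Set} (xs : List A) (ys : List B) (f : A → B → ℚ) →
         ∑ xs (λ x → ∑ ys (f x)) ≡ ∑ ys (λ y → ∑ xs (λ x → f x y))
∑-comm []       ys f = sym (∑-zero ys λ _ → refl)
∑-comm (x ∷ xs) ys f rewrite ∑-comm xs ys f = sym (∑-+ ys (f x) (λ y → ∑ xs (λ x → f x y)))

module _ {A : Set} (_≟_ : DecidableEquality A) where

  ∑-≤-support : ∀ {xs ys} {f : A → ℚ} → Unique xs → (∀ x → 0ℚ ≤ f x) →
                (∀ {x} → x ∈ xs → x ∉ ys → f x ≡ 0ℚ) → ∑ xs f ≤ ∑ ys f
  ∑-≤-support {[]}     {ys}     _          0≤f _   = ∑-nonneg ys 0≤f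
  ∑-≤-support {x ∷ xs} {ys} {f} (x∉xs ∷ u) 0≤f out with member? _≟_ x ys
  ... | no x∉ys rewrite out (here refl) x∉ys =
    ≤-trans (≤-reflexive (+-identityˡ _)) (∑-≤-support u 0≤f (λ y∈xs → out (there y∈xs)))
  ... | yes x∈ys with ys′ , ys↭ ← ∈⇒↭∷ x∈ys = begin
    f x + ∑ xs f   ≤⟨ +-monoʳ-≤ (f x) (∑-≤-support u 0≤f out′) ⟩
    f x + ∑ ys′ f  ≡⟨ ∑-↭ f (↭-sym ys↭) ⟩
    ∑ ys f         ∎
    where
    open ≤-Reasoning
    out′ : ∀ {y} → y ∈ xs → y ∉ ys′ → f y ≡ 0ℚ
    out′ y∈xs y∉ys′ = out (there y∈xs) λ y∈ys → case ∈-resp-↭ ys↭ y∈ys of λ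
      { (here refl) → All.lookup x∉xs y∈xs refl
      ; (there y∈ys′) → y∉ys′ y∈ys′ }

  ∑-≡-support : ∀ {xs ys} {f : A → ℚ} → Unique xs → Unique ys → (∀ x → 0ℚ ≤ f x) →
                (∀ {x} → x ∈ xs → x ∉ ys → f x ≡ 0ℚ) →
                (∀ {x} → x ∈ ys → x ∉ xs → f x ≡ 0ℚ) →
                ∑ xs f ≡ ∑ ys f
  ∑-≡-support uxs uys 0≤f outˡ outʳ =
    ≤-antisym (∑-≤-support uxs 0≤f outˡ) (∑-≤-support uys 0≤f outʳ)

-- Subdistributions

open import Data.List.Relation.Unary.Unique.DecPropositional.Properties _≟ᵛ_
  using (deduplicate-!)

Bounded : (Val → ℚ) → Set
Bounded m = ∀ {xs} → Unique xs → ∑ xs m ≤ 1ℚ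

mass-bounded : (E : SubDist) → Bounded (mass E)
mass-bounded E u =
  ≤-trans (∑-≤-support _≟ᵛ_ u (mass-nonneg E) (λ {v} _ → mass-out E v)) (mass-total E)

fromCandidates : (m : Val → ℚ) (cs : List Val) → All ClosedV cs →
                 (∀ v → v ∉ cs → m v ≡ 0ℚ) → (∀ v → 0ℚ ≤ m v) → Bounded m → SubDist
fromCandidates m cs closed out 0≤m bounded = record
  { mass        = m
  ; supp        = deduplicate _≟ᵛ_ cs
  ; supp-unique = deduplicate-! cs
  ; supp-closed = All.deduplicate⁺ _≟ᵛ_ closed
  ; mass-nonneg = 0≤m
  ; mass-out    = λ v v∉ → out v (v∉ ∘′ ∈-deduplicate⁺ _≟ᵛ_)
  ; mass-total  = bounded (deduplicate-! cs)
  }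

zeroD : SubDist
zeroD = fromCandidates (λ _ → 0ℚ) [] [] (λ _ _ → refl) (λ _ → ≤-refl)
  (λ {xs} _ → ≤-trans (≤-reflexive (∑-zero xs λ _ → refl)) (≤ᵇ⇒≤ _))

δ : Val → Val → ℚ
δ v u with u ≟ᵛ v
... | yes _ = 1ℚ
... | no  _ = 0ℚ

δ-same : ∀ v → δ v v ≡ 1ℚ
δ-same v with v ≟ᵛ v
... | yes _   = refl
... | no  v≢v = ⊥-elim (v≢v refl)

δ-other : ∀ {v u} → u ≢ v → δ v u ≡ 0ℚ
δ-other {v} {u} u≢v with u ≟ᵛ v
... | yes u≡v = ⊥-elim (u≢v u≡v)
... | no  _   = refl

δ-nonneg : ∀ v u → 0ℚ ≤ δ v u
δ-nonneg v u with u ≟ᵛ v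
... | yes _ = ≤ᵇ⇒≤ _
... | no  _ = ≤-refl

diracD : (v : Val) → ClosedV v → SubDist
diracD v closed = fromCandidates (δ v) (v ∷ []) (closed ∷ []) out (δ-nonneg v) bounded
  where
  out : ∀ u → u ∉ v ∷ [] → δ v u ≡ 0ℚ
  out u u∉ = δ-other (u∉ ∘′ here)
  bounded : Bounded (δ v)
  bounded u = ≤-trans (∑-≤-support _≟ᵛ_ u (δ-nonneg v) (λ {w} _ → out w))
                      (≤-reflexive (trans (+-identityʳ (δ v v)) (δ-same v)))

module _ {p q : ℚ} (0≤p : 0ℚ ≤ p) (0≤q : 0ℚ ≤ q) (p+q≤1 : p + q ≤ 1ℚ) where

  mixD : SubDist → SubDist → SubDist
  mixD E F = fromCandidates m (supp E ++ supp F) (All.++⁺ (supp-closed E) (supp-closed F))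
                            out 0≤m bounded
    where
    m : Val → ℚ
    m u = p * mass E u + q * mass F u
    out : ∀ u → u ∉ supp E ++ supp F → m u ≡ 0ℚ
    out u u∉ rewrite mass-out E u (u∉ ∘′ ∈-++⁺ˡ) | mass-out F u (u∉ ∘′ ∈-++⁺ʳ (supp E))
                   | *-zeroʳ p | *-zeroʳ q = refl
    0≤m : ∀ u → 0ℚ ≤ m u
    0≤m u = +-mono-≤ (*-nonneg 0≤p (mass-nonneg E u)) (*-nonneg 0≤q (mass-nonneg F u))
    bounded : Bounded m
    bounded {xs} u = begin
      ∑ xs m
        ≡⟨ ∑-+ xs _ _ ⟩
      ∑ xs (λ u → p * mass E u) + ∑ xs (λ u → q * mass F u)
        ≡⟨ cong₂ _+_ (∑-*ˡ xs p (mass E)) (∑-*ˡ xs q (mass F)) ⟩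
      p * ∑ xs (mass E) + q * ∑ xs (mass F)
        ≤⟨ +-mono-≤ (*-monoʳ-≤-nonneg 0≤p (mass-bounded E u))
                    (*-monoʳ-≤-nonneg 0≤q (mass-bounded F u)) ⟩
      p * 1ℚ + q * 1ℚ
        ≡⟨ cong₂ _+_ (*-identityʳ p) (*-identityʳ q) ⟩
      p + q
        ≤⟨ p+q≤1 ⟩
      1ℚ ∎
      where open ≤-Reasoning

bindMass : SubDist → (Val → SubDist) → Val → ℚ
bindMass E K u = ∑ (supp E) (λ v → mass E v * mass (K v) u)

bindD : SubDist → (Val → SubDist) → SubDist
bindD E K = fromCandidates (bindMass E K) cs closed out 0≤m bounded
  where
  cs : List Val
  cs = concatMap (supp ∘′ K) (supp E)
  closed : All ClosedV cs
  closed = All.concat⁺ (All.map⁺ {xs = supp E} (All.tabulate λ {v} _ → supp-closed (K v)))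
  out : ∀ u → u ∉ cs → bindMass E K u ≡ 0ℚ
  out u u∉ = ∑-zero (supp E) λ {v} v∈ →
    let u∉Kv = λ u∈ → u∉ (∈-concatMap⁺ (supp ∘′ K) (Any.map (λ { refl → u∈ }) v∈))
    in trans (cong (mass E v *_) (mass-out (K v) u u∉Kv)) (*-zeroʳ (mass E v))
  0≤m : ∀ u → 0ℚ ≤ bindMass E K u
  0≤m u = ∑-nonneg (supp E) λ v → *-nonneg (mass-nonneg E v) (mass-nonneg (K v) u)
  bounded : Bounded (bindMass E K)
  bounded {xs} u = begin
    ∑ xs (bindMass E K)
      ≡⟨ ∑-comm xs (supp E) _ ⟩
    ∑ (supp E) (λ v → ∑ xs (λ u → mass E v * mass (K v) u))
      ≡⟨ ∑-cong (supp E) (λ {v} _ → ∑-*ˡ xs (mass E v) (mass (K v))) ⟩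
    ∑ (supp E) (λ v → mass E v * ∑ xs (mass (K v)))
      ≤⟨ ∑-mono-≤ (supp E) (λ {v} _ → *-monoʳ-≤-nonneg (mass-nonneg E v) (mass-bounded (K v) u)) ⟩
    ∑ (supp E) (λ v → mass E v * 1ℚ)
      ≡⟨ ∑-cong (supp E) (λ {v} _ → *-identityʳ (mass E v)) ⟩
    ∑ (supp E) (mass E)
      ≤⟨ mass-total E ⟩
    1ℚ ∎
    where open ≤-Reasoning

bindMass-zeroD : ∀ E u → bindMass E (λ _ → zeroD) u ≡ 0ℚ
bindMass-zeroD E u = ∑-zero (supp E) λ {v} _ → *-zeroʳ (mass E v)

bindMass-cong : ∀ {E E′ K K′} → E ≈D E′ → (∀ v → 0ℚ < mass E v → K v ≈D K′ v) →
                ∀ u → bindMass E K u ≡ bindMass E′ K′ u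
bindMass-cong {E} {E′} {K} {K′} E≈E′ K≈K′ u = begin
  ∑ (supp E)  (λ v → mass E v * mass (K v) u)
    ≡⟨ ∑-cong (supp E) (λ {v} _ → term-cong v) ⟩
  ∑ (supp E)  (λ v → mass E′ v * mass (K′ v) u)
    ≡⟨ ∑-≡-support _≟ᵛ_ (supp-unique E) (supp-unique E′) 0≤term outˡ outʳ ⟩
  ∑ (supp E′) (λ v → mass E′ v * mass (K′ v) u) ∎
  where
  open ≡-Reasoning
  vanish : ∀ {v} → mass E′ v ≡ 0ℚ → mass E′ v * mass (K′ v) u ≡ 0ℚ
  vanish {v} E′v≡0 = trans (cong (_* mass (K′ v) u) E′v≡0) (*-zeroˡ (mass (K′ v) u))
  term-cong : ∀ v → mass E v * mass (K v) u ≡ mass E′ v * mass (K′ v) u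
  term-cong v with nonneg⇒≡0⊎pos (mass-nonneg E v)
  ... | inj₂ 0<Ev = cong₂ _*_ (E≈E′ v) (K≈K′ v 0<Ev u)
  ... | inj₁ Ev≡0 = trans (trans (cong (_* mass (K v) u) Ev≡0) (*-zeroˡ (mass (K v) u)))
                          (sym (vanish (trans (sym (E≈E′ v)) Ev≡0)))
  0≤term : ∀ v → 0ℚ ≤ mass E′ v * mass (K′ v) u
  0≤term v = *-nonneg (mass-nonneg E′ v) (mass-nonneg (K′ v) u)
  outˡ : ∀ {v} → v ∈ supp E → v ∉ supp E′ → mass E′ v * mass (K′ v) u ≡ 0ℚ
  outˡ {v} _ v∉ = vanish (mass-out E′ v v∉)
  outʳ : ∀ {v} → v ∈ supp E′ → v ∉ supp E → mass E′ v * mass (K′ v) u ≡ 0ℚ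
  outʳ {v} _ v∉ = vanish (trans (sym (E≈E′ v)) (mass-out E v v∉))

record AllCharged (P : Val → Set) (E : SubDist) : Set where
  constructor allCharged
  field charged : ∀ v → 0ℚ < mass E v → P v
open AllCharged

module _ {P : Val → Set} where

  AllCharged-map : ∀ {Q : Val → Set} {E} → (∀ {v} → P v → Q v) → AllCharged P E → AllCharged Q E
  AllCharged-map P⇒Q PE = allCharged λ v 0<Ev → P⇒Q (charged PE v 0<Ev)

  zeroD-charged : AllCharged P zeroD
  zeroD-charged = allCharged λ _ 0<0 → ⊥-elim (0≮0 0<0)

  diracD-charged : ∀ {v} (closed : ClosedV v) → P v → AllCharged P (diracD v closed)
  diracD-charged {v} _ Pv = allCharged charged-δ
    where
    charged-δ : ∀ u → 0ℚ < δ v u → P u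
    charged-δ u 0<δ with u ≟ᵛ v
    ... | yes refl = Pv
    ... | no  _    = ⊥-elim (0≮0 0<δ)

  mixD-charged : ∀ {p q} (0≤p : 0ℚ ≤ p) (0≤q : 0ℚ ≤ q) (p+q≤1 : p + q ≤ 1ℚ) {E F} →
                 AllCharged P E → AllCharged P F → AllCharged P (mixD 0≤p 0≤q p+q≤1 E F)
  mixD-charged {p} {q} 0≤p 0≤q _ {E} {F} PE PF = allCharged charged-mix
    where
    charged-mix : ∀ u → 0ℚ < p * mass E u + q * mass F u → P u
    charged-mix u 0<m
      with +-pos⁻ (*-nonneg 0≤p (mass-nonneg E u)) (*-nonneg 0≤q (mass-nonneg F u)) 0<m
    ... | inj₁ 0<pE = charged PE u (proj₂ (*-pos⁻ 0≤p (mass-nonneg E u) 0<pE))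
    ... | inj₂ 0<qF = charged PF u (proj₂ (*-pos⁻ 0≤q (mass-nonneg F u) 0<qF))

  bindD-charged : ∀ {E K} → (∀ v → 0ℚ < mass E v → AllCharged P (K v)) → AllCharged P (bindD E K)
  bindD-charged {E} {K} PK = allCharged charged-bind
    where
    charged-bind : ∀ u → 0ℚ < bindMass E K u → P u
    charged-bind u 0<m
      with ∑-pos⁻ (supp E) (λ v → *-nonneg (mass-nonneg E v) (mass-nonneg (K v) u)) 0<m
    ... | v , 0<term with *-pos⁻ (mass-nonneg E v) (mass-nonneg (K v) u) 0<term
    ... | 0<Ev , 0<Kvu = charged (PK v 0<Ev) u 0<Kvu

onLam : (Val → Val → SubDist) → Val → Val → SubDist
onLam G (lam x s) w = G (lam x s) w
onLam G _         w = zeroD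

onPair : (Val → Val → SubDist) → Val → SubDist
onPair G (pair v w) = G v w
onPair G _          = zeroD

appMass≡bindMass : ∀ E F G u → appMass E F G u ≡ bindMass E (λ v → bindD F (onLam G v)) u
appMass≡bindMass E F G u = ∑-cong (supp E) λ
  { {lam x s}  _ → trans (∑-cong (supp F) λ {w} _ → *-assoc (mass E (lam x s)) (mass F w) _)
                         (∑-*ˡ (supp F) (mass E (lam x s)) _)
  ; {var y}    _ → vanishes (mass E (var y))
  ; {tt}       _ → vanishes (mass E tt)
  ; {ff}       _ → vanishes (mass E ff)
  ; {pair v w} _ → vanishes (mass E (pair v w))
  }
  where
  vanishes : ∀ c → ∑ (supp F) (λ _ → 0ℚ) ≡ c * bindMass F (λ _ → zeroD) u
  vanishes c = trans (∑-zero (supp F) λ _ → refl)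
                     (sym (trans (cong (c *_) (bindMass-zeroD F u)) (*-zeroʳ c)))

letMass≡bindMass : ∀ E G u → letMass E G u ≡ bindMass E (onPair G) u
letMass≡bindMass E G u = ∑-cong (supp E) λ
  { {pair _ _} _ → refl
  ; {var y}    _ → sym (*-zeroʳ (mass E (var y)))
  ; {tt}       _ → sym (*-zeroʳ (mass E tt))
  ; {ff}       _ → sym (*-zeroʳ (mass E ff))
  ; {lam x s}  _ → sym (*-zeroʳ (mass E (lam x s)))
  }

-- Uniqueness

⇓-deterministic : ∀ {e E E′} → e ⇓ E → e ⇓ E′ → E ≈D E′
⇓-deterministic {val v} (ev-val Ev≡1 E≡0) (ev-val E′v≡1 E′≡0) u with u ≟ᵛ v
... | yes refl = trans Ev≡1 (sym E′v≡1)
... | no  u≢v  = trans (E≡0 u u≢v) (sym (E′≡0 u u≢v))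
⇓-deterministic (ev-Ω E≡0) (ev-Ω E′≡0) u = trans (E≡0 u) (sym (E′≡0 u))
⇓-deterministic (ev-⊕ d₁ d₂ H≡) (ev-⊕ d₁′ d₂′ H′≡) u =
  trans (H≡ u) (trans (cong₂ (λ a b → ½ * a + ½ * b) (⇓-deterministic d₁ d₁′ u)
                                                     (⇓-deterministic d₂ d₂′ u))
                      (sym (H′≡ u)))
⇓-deterministic (ev-if d₁ d₂ d₃ H≡) (ev-if d₁′ d₂′ d₃′ H′≡) u =
  trans (H≡ u) (trans (cong₂ _+_ (cong₂ _*_ (⇓-deterministic d₁ d₁′ tt) (⇓-deterministic d₂ d₂′ u))
                                 (cong₂ _*_ (⇓-deterministic d₁ d₁′ ff) (⇓-deterministic d₃ d₃′ u)))
                      (sym (H′≡ u)))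
⇓-deterministic (ev-app {E = E} {F} {H} G d₁ d₂ dG H≡)
                (ev-app {E = E′} {F′} {H′} G′ d₁′ d₂′ dG′ H′≡) u = begin
  mass H u            ≡⟨ H≡ u ⟩
  appMass E F G u     ≡⟨ appMass≡bindMass E F G u ⟩
  bindMass E K u      ≡⟨ bindMass-cong {E} {E′} {K} {K′} E≈E′ K≈K′ u ⟩
  bindMass E′ K′ u    ≡⟨ appMass≡bindMass E′ F′ G′ u ⟨
  appMass E′ F′ G′ u  ≡⟨ H′≡ u ⟨
  mass H′ u           ∎
  where
  open ≡-Reasoning
  E≈E′ = ⇓-deterministic d₁ d₁′
  F≈F′ = ⇓-deterministic d₂ d₂′
  K K′ : Val → SubDist
  K  v = bindD F  (onLam G v)
  K′ v = bindD F′ (onLam G′ v)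
  onLam-cong : ∀ v → 0ℚ < mass E v → ∀ w → 0ℚ < mass F w → onLam G v w ≈D onLam G′ v w
  onLam-cong (lam x s) 0<Ev w 0<Fw =
    ⇓-deterministic (dG x s w 0<Ev 0<Fw)
                    (dG′ x s w (transport (0ℚ <_) (E≈E′ _) 0<Ev) (transport (0ℚ <_) (F≈F′ w) 0<Fw))
  onLam-cong (var _)    _ _ _ _ = refl
  onLam-cong tt         _ _ _ _ = refl
  onLam-cong ff         _ _ _ _ = refl
  onLam-cong (pair _ _) _ _ _ _ = refl
  K≈K′ : ∀ v → 0ℚ < mass E v → K v ≈D K′ v
  K≈K′ v 0<Ev = bindMass-cong {F} {F′} {onLam G v} {onLam G′ v} F≈F′ (onLam-cong v 0<Ev)
⇓-deterministic (ev-let {E = E} {H = H} G d dG H≡) (ev-let {E = E′} {H = H′} G′ d′ dG′ H′≡) u =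
  begin
  mass H u                   ≡⟨ H≡ u ⟩
  letMass E G u              ≡⟨ letMass≡bindMass E G u ⟩
  bindMass E (onPair G) u    ≡⟨ bindMass-cong {E} {E′} {onPair G} {onPair G′} E≈E′ onPair-cong u ⟩
  bindMass E′ (onPair G′) u  ≡⟨ letMass≡bindMass E′ G′ u ⟨
  letMass E′ G′ u            ≡⟨ H′≡ u ⟨
  mass H′ u                  ∎
  where
  open ≡-Reasoning
  E≈E′ = ⇓-deterministic d d′
  onPair-cong : ∀ v → 0ℚ < mass E v → onPair G v ≈D onPair G′ v
  onPair-cong (pair v w) 0<Ev =
    ⇓-deterministic (dG v w 0<Ev) (dG′ v w (transport (0ℚ <_) (E≈E′ _) 0<Ev))
  onPair-cong (var _)    _ _ = refl
  onPair-cong tt         _ _ = refl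
  onPair-cong ff         _ _ = refl
  onPair-cong (lam _ _)  _ _ = refl

dom⁺ : ∀ {Γ Δ} → Γ ⊆ Δ → dom Γ ⊆ dom Δ
dom⁺ = ⊆.map⁺ proj₁

∈-dom : ∀ {x A Γ} → (x , A) ∈ Γ → x ∈ dom Γ
∈-dom = ∈-map⁺ proj₁

split-⊆ˡ : ∀ {Γ Γ₁ Γ₂} → Split Γ Γ₁ Γ₂ → Γ₁ ⊆ Γ
split-⊆ˡ {Γ₂ = Γ₂} (_ , Γ↭) = ⊆-trans (xs⊆xs++ys _ Γ₂) (⊆-reflexive-↭ (↭-sym Γ↭))

split-⊆ʳ : ∀ {Γ Γ₁ Γ₂} → Split Γ Γ₁ Γ₂ → Γ₂ ⊆ Γ
split-⊆ʳ {Γ₁ = Γ₁} (_ , Γ↭) = ⊆-trans (xs⊆ys++xs _ Γ₁) (⊆-reflexive-↭ (↭-sym Γ↭))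

split-[]⁻ : ∀ {Γ₁ Γ₂} → Split [] Γ₁ Γ₂ → Γ₁ ≡ [] × Γ₂ ≡ []
split-[]⁻ {Γ₁} {Γ₂} (_ , []↭) = ++-conicalˡ Γ₁ Γ₂ Γ₁++Γ₂≡[] , ++-conicalʳ Γ₁ Γ₂ Γ₁++Γ₂≡[]
  where Γ₁++Γ₂≡[] = ↭-empty-inv (↭-sym []↭)

head∈dom : ∀ {Γ x A Γ′} → Γ ↭ (x , A) ∷ Γ′ → x ∈ dom Γ
head∈dom Γ↭ = ∈-dom (∈-resp-↭ (↭-sym Γ↭) (here refl))

tail⊆ : ∀ {Γ Γ′ : Ctx} {x A} → Γ ↭ (x , A) ∷ Γ′ → Γ′ ⊆ Γ
tail⊆ Γ↭ = ⊆-reflexive-↭ (↭-sym Γ↭) ∘′ there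

data Located (x : Var) (A : Ty) (Γ′ Γ₁ Γ₂ : Ctx) : Set where
  left  : ∀ {Γ₁′} → Γ₁ ↭ (x , A) ∷ Γ₁′ → Split Γ′ Γ₁′ Γ₂ → x ∉ dom Γ₂ → Located x A Γ′ Γ₁ Γ₂
  right : ∀ {Γ₂′} → Γ₂ ↭ (x , A) ∷ Γ₂′ → Split Γ′ Γ₁ Γ₂′ → x ∉ dom Γ₁ → Located x A Γ′ Γ₁ Γ₂

locate : ∀ {Γ Γ₁ Γ₂ x A Γ′} → Split Γ Γ₁ Γ₂ → Γ ↭ (x , A) ∷ Γ′ → Located x A Γ′ Γ₁ Γ₂
locate {Γ₁ = Γ₁} {Γ₂} {x} {A} (disjoint , Γ↭) Γ↭x
  with ∈-++⁻ Γ₁ (∈-resp-↭ Γ↭ (∈-resp-↭ (↭-sym Γ↭x) (here refl)))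
... | inj₁ x∈Γ₁ with Γ₁′ , Γ₁↭ ← ∈⇒↭∷ x∈Γ₁ =
  left Γ₁↭ ((λ (y∈Γ₁′ , y∈Γ₂) → disjoint (dom⁺ (tail⊆ Γ₁↭) y∈Γ₁′ , y∈Γ₂)) ,
            drop-∷ (↭-trans (↭-sym Γ↭x) (↭-trans Γ↭ (↭.++⁺ʳ Γ₂ Γ₁↭))))
       (λ x∈Γ₂ → disjoint (∈-dom x∈Γ₁ , x∈Γ₂))
... | inj₂ x∈Γ₂ with Γ₂′ , Γ₂↭ ← ∈⇒↭∷ x∈Γ₂ =
  right Γ₂↭ ((λ (y∈Γ₁ , y∈Γ₂′) → disjoint (y∈Γ₁ , dom⁺ (tail⊆ Γ₂↭) y∈Γ₂′)) ,
             drop-∷ (↭-trans (↭-sym Γ↭x)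
                    (↭-trans Γ↭ (↭-trans (↭.++⁺ˡ Γ₁ Γ₂↭) (shift (x , A) Γ₁ Γ₂′)))))
        (λ x∈Γ₁ → disjoint (x∈Γ₁ , ∈-dom x∈Γ₂))

∈∉⇒≢ : ∀ {x y : Var} {xs} → x ∈ xs → y ∉ xs → x ≢ y
∈∉⇒≢ x∈ y∉ refl = y∉ x∈

∉-∷ : ∀ {x y : Var} {ys} → x ≢ y → x ∉ ys → x ∉ y ∷ ys
∉-∷ x≢y _   (here x≡y)   = x≢y x≡y
∉-∷ _   x∉ys (there x∈ys) = x∉ys x∈ys

remove-∷-same : ∀ x ys → remove x (x ∷ ys) ≡ remove x ys
remove-∷-same x ys rewrite dec-true (x ℕ.≟ x) refl = refl

remove-∷-other : ∀ {x y} ys → x ≢ y → remove x (y ∷ ys) ≡ y ∷ remove x ys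
remove-∷-other {x} {y} ys x≢y rewrite dec-false (x ℕ.≟ y) x≢y = refl

∈-remove⁻ : ∀ x ys {z} → z ∈ remove x ys → z ∈ ys × z ≢ x
∈-remove⁻ x (y ∷ ys) {z} z∈ with x ℕ.≟ y
... | yes refl = Product.map₁ there (∈-remove⁻ x ys (transport (z ∈_) (remove-∷-same x ys) z∈))
... | no x≢y with transport (z ∈_) (remove-∷-other ys x≢y) z∈
...   | here refl = here refl , x≢y ∘′ sym
...   | there z∈′ = Product.map₁ there (∈-remove⁻ x ys z∈′)

fv⊆dom : ∀ {Γ e A} → Γ ⊢ e ∶ A → fv e ⊆ dom Γ
fv⊆dom ty-var z∈ = z∈
fv⊆dom (ty-lam {x = x} _ d) z∈ with ∈-remove⁻ x _ z∈
... | z∈fv , z≢x with fv⊆dom d z∈fv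
...   | here z≡x = ⊥-elim (z≢x z≡x)
...   | there z∈Γ = z∈Γ
fv⊆dom (ty-app {e = e} d₁ d₂ s) z∈ with ∈-++⁻ (fv e) z∈
... | inj₁ z∈e = dom⁺ (split-⊆ˡ s) (fv⊆dom d₁ z∈e)
... | inj₂ z∈f = dom⁺ (split-⊆ʳ s) (fv⊆dom d₂ z∈f)
fv⊆dom (ty-pair {v = v} d₁ d₂ s) z∈ with ∈-++⁻ (fvV v) z∈
... | inj₁ z∈v = dom⁺ (split-⊆ˡ s) (fv⊆dom d₁ z∈v)
... | inj₂ z∈w = dom⁺ (split-⊆ʳ s) (fv⊆dom d₂ z∈w)
fv⊆dom (ty-let {x = x} {y} {f = f} _ _ _ d₁ d₂ s) z∈ with ∈-++⁻ (fv f) z∈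
... | inj₁ z∈f = dom⁺ (split-⊆ʳ s) (fv⊆dom d₂ z∈f)
... | inj₂ z∈body with ∈-remove⁻ x _ z∈body
...   | z∈′ , z≢x with ∈-remove⁻ y _ z∈′
...     | z∈e , z≢y with fv⊆dom d₁ z∈e
...       | here z≡x         = ⊥-elim (z≢x z≡x)
...       | there (here z≡y) = ⊥-elim (z≢y z≡y)
...       | there (there z∈Γ₁) = dom⁺ (split-⊆ˡ s) z∈Γ₁
fv⊆dom (ty-if {e = e} {f = f} d₁ d₂ d₃ s) z∈ with ∈-++⁻ (fv e) z∈
... | inj₁ z∈e = dom⁺ (split-⊆ˡ s) (fv⊆dom d₁ z∈e)
... | inj₂ z∈fg with ∈-++⁻ (fv f) z∈fg
...   | inj₁ z∈f = dom⁺ (split-⊆ʳ s) (fv⊆dom d₂ z∈f)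
...   | inj₂ z∈g = dom⁺ (split-⊆ʳ s) (fv⊆dom d₃ z∈g)
fv⊆dom (ty-⊕ {e = e} d₁ d₂) z∈ with ∈-++⁻ (fv e) z∈
... | inj₁ z∈e = fv⊆dom d₁ z∈e
... | inj₂ z∈f = fv⊆dom d₂ z∈f

typed-closed : ∀ {v A} → [] ⊢ val v ∶ A → ClosedV v
typed-closed {v} d with fvV v | fv⊆dom d
... | []    | _      = refl
... | z ∷ _ | fv⊆[] with () ← fv⊆[] (here refl)

-- Substitution of closed values

module _ {x : Var} {w : Val} where

  substV-var-same : substV (var x) x w ≡ w
  substV-var-same rewrite dec-true (x ℕ.≟ x) refl = refl

  subst-var-other : ∀ {y} → x ≢ y → subst (val (var y)) x w ≡ val (var y)
  subst-var-other {y} x≢y rewrite dec-false (x ℕ.≟ y) x≢y = refl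

  substV-lam-same : ∀ {e} → substV (lam x e) x w ≡ lam x e
  substV-lam-same rewrite dec-true (x ℕ.≟ x) refl = refl

  substV-lam-other : ∀ {y e} → x ≢ y → substV (lam y e) x w ≡ lam y (subst e x w)
  substV-lam-other {y} x≢y rewrite dec-false (x ℕ.≟ y) x≢y = refl

  -- how subst acts on the body of  letp f y z e
  substBody : Var → Var → Term → Term
  substBody y z e = if does (x ℕ.≟ y) then e else if does (x ℕ.≟ z) then e else subst e x w

  substBody-other : ∀ {y z e} → x ≢ y → x ≢ z → substBody y z e ≡ subst e x w
  substBody-other {y} {z} x≢y x≢z rewrite dec-false (x ℕ.≟ y) x≢y | dec-false (x ℕ.≟ z) x≢z = refl

  substBody-inert : ∀ {y z e} → (x ≢ y → x ≢ z → subst e x w ≡ e) → substBody y z e ≡ e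
  substBody-inert {y} {z} inert with x ℕ.≟ y | x ℕ.≟ z
  ... | yes refl | _        rewrite dec-true (x ℕ.≟ x) refl = refl
  ... | no x≢y   | yes refl rewrite dec-false (x ℕ.≟ y) x≢y | dec-true (x ℕ.≟ x) refl = refl
  ... | no x≢y   | no x≢z   = trans (substBody-other x≢y x≢z) (inert x≢y x≢z)

val-injective : ∀ {v w} → val v ≡ val w → v ≡ w
val-injective refl = refl

subst-fresh : ∀ {Γ e B x} w → Γ ⊢ e ∶ B → x ∉ dom Γ → subst e x w ≡ e
subst-fresh w ty-var x∉ = subst-var-other (x∉ ∘′ here)
subst-fresh w ty-tt _ = refl
subst-fresh w ty-ff _ = refl
subst-fresh w (ty-Ω _) _ = refl
subst-fresh {x = x} w (ty-lam {x = y} _ d) x∉ with x ℕ.≟ y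
... | yes refl = cong val substV-lam-same
... | no x≢y   =
  cong val (trans (substV-lam-other x≢y) (cong (lam y) (subst-fresh w d (∉-∷ x≢y x∉))))
subst-fresh w (ty-app d₁ d₂ s) x∉ =
  cong₂ app (subst-fresh w d₁ (x∉ ∘′ dom⁺ (split-⊆ˡ s)))
            (subst-fresh w d₂ (x∉ ∘′ dom⁺ (split-⊆ʳ s)))
subst-fresh w (ty-pair d₁ d₂ s) x∉ =
  cong₂ (λ a b → val (pair a b)) (val-injective (subst-fresh w d₁ (x∉ ∘′ dom⁺ (split-⊆ˡ s))))
                                 (val-injective (subst-fresh w d₂ (x∉ ∘′ dom⁺ (split-⊆ʳ s))))
subst-fresh w (ty-let _ _ _ d₁ d₂ s) x∉ =
  cong₂ (λ f e → letp f _ _ e) (subst-fresh w d₂ (x∉ ∘′ dom⁺ (split-⊆ʳ s)))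
    (substBody-inert λ x≢y x≢z → subst-fresh w d₁ (∉-∷ x≢y (∉-∷ x≢z (x∉ ∘′ dom⁺ (split-⊆ˡ s)))))
subst-fresh w (ty-if d₁ d₂ d₃ s) x∉
  rewrite subst-fresh w d₁ (x∉ ∘′ dom⁺ (split-⊆ˡ s))
        | subst-fresh w d₂ (x∉ ∘′ dom⁺ (split-⊆ʳ s))
        | subst-fresh w d₃ (x∉ ∘′ dom⁺ (split-⊆ʳ s)) = refl
subst-fresh w (ty-⊕ d₁ d₂) x∉ = cong₂ _⊕_ (subst-fresh w d₁ x∉) (subst-fresh w d₂ x∉)

mutual
  sizeᵛ : Val → ℕ
  sizeᵛ (var _)    = 0
  sizeᵛ tt         = 0
  sizeᵛ ff         = 0
  sizeᵛ (lam _ e)  = size e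
  sizeᵛ (pair v w) = sizeᵛ v +ₙ sizeᵛ w

  size : Term → ℕ
  size (val v)        = sizeᵛ v
  size (app e f)      = suc (size e +ₙ size f)
  size (ifte e f g)   = suc (size e +ₙ (size f ⊔ size g))
  size (letp f _ _ e) = suc (size f +ₙ size e)
  size Ω              = 0
  size (e ⊕ f)        = suc (size e ⊔ size f)

+-monoˡ-≤-offset : ∀ {a′ a} b k → a′ ≤ₙ a +ₙ k → a′ +ₙ b ≤ₙ (a +ₙ b) +ₙ k
+-monoˡ-≤-offset {a = a} b k a′≤ =
  ℕₚ.≤-trans (ℕₚ.+-monoˡ-≤ b a′≤) (ℕₚ.≤-reflexive (ℕ+.xy∙z≈xz∙y a k b))

+-monoʳ-≤-offset : ∀ a {b′ b} k → b′ ≤ₙ b +ₙ k → a +ₙ b′ ≤ₙ (a +ₙ b) +ₙ k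
+-monoʳ-≤-offset a {b = b} k b′≤ =
  ℕₚ.≤-trans (ℕₚ.+-monoʳ-≤ a b′≤) (ℕₚ.≤-reflexive (sym (ℕₚ.+-assoc a b k)))

⊔-mono-≤-offset : ∀ {b′ b c′ c} k → b′ ≤ₙ b +ₙ k → c′ ≤ₙ c +ₙ k → b′ ⊔ c′ ≤ₙ (b ⊔ c) +ₙ k
⊔-mono-≤-offset {b = b} {c = c} k b′≤ c′≤ =
  ℕₚ.≤-trans (ℕₚ.⊔-mono-≤ b′≤ c′≤) (ℕₚ.≤-reflexive (sym (ℕₚ.+-distribʳ-⊔ k b c)))

Substituted : Ctx → Term → Ty → Var → Val → Set
Substituted Γ s B x w = Γ ⊢ subst s x w ∶ B × size (subst s x w) ≤ₙ size s +ₙ sizeᵛ w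

subst-typed : ∀ {Γ s B x A Γ′ w} → Γ ⊢ s ∶ B → Γ ↭ (x , A) ∷ Γ′ → [] ⊢ val w ∶ A →
              Substituted Γ′ s B x w
subst-typed {x = x} {w = w} ty-var Γ↭ ⊢w with refl ← ↭-singleton-inv (↭-sym Γ↭)
  rewrite substV-var-same {x} {w} = ⊢w , ℕₚ.≤-refl
subst-typed ty-tt Γ↭ _ = ⊥-elim (¬x∷xs↭[] (↭-sym Γ↭))
subst-typed ty-ff Γ↭ _ = ⊥-elim (¬x∷xs↭[] (↭-sym Γ↭))
subst-typed (ty-Ω unique) Γ↭ _ with _ ∷ unique′ ← Unique-resp-↭ (↭⇒↭ₛ (↭.map⁺ proj₁ Γ↭)) unique =
  ty-Ω unique′ , z≤n
subst-typed {x = x} {w = w} (ty-lam {x = y} {e} y∉Γ d) Γ↭ ⊢w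
  rewrite substV-lam-other {x} {w} {y} {e} (∈∉⇒≢ (head∈dom Γ↭) y∉Γ)
  with ⊢s′ , s′≤ ← subst-typed d (↭-trans (↭.prep _ Γ↭) (↭.swap _ _ ↭.refl)) ⊢w =
  ty-lam (y∉Γ ∘′ dom⁺ (tail⊆ Γ↭)) ⊢s′ , s′≤
subst-typed {w = w} (ty-app {e = e} {f} d₁ d₂ s) Γ↭ ⊢w with locate s Γ↭
... | left Γ₁↭ s′ x∉Γ₂ rewrite subst-fresh w d₂ x∉Γ₂ with ⊢e′ , e′≤ ← subst-typed d₁ Γ₁↭ ⊢w =
  ty-app ⊢e′ d₂ s′ , s≤s (+-monoˡ-≤-offset (size f) (sizeᵛ w) e′≤)
... | right Γ₂↭ s′ x∉Γ₁ rewrite subst-fresh w d₁ x∉Γ₁ with ⊢f′ , f′≤ ← subst-typed d₂ Γ₂↭ ⊢w =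
  ty-app d₁ ⊢f′ s′ , s≤s (+-monoʳ-≤-offset (size e) (sizeᵛ w) f′≤)
subst-typed {w = w} (ty-pair {v = v} {u} d₁ d₂ s) Γ↭ ⊢w with locate s Γ↭
... | left Γ₁↭ s′ x∉Γ₂ rewrite val-injective (subst-fresh w d₂ x∉Γ₂)
  with ⊢v′ , v′≤ ← subst-typed d₁ Γ₁↭ ⊢w =
  ty-pair ⊢v′ d₂ s′ , +-monoˡ-≤-offset (sizeᵛ u) (sizeᵛ w) v′≤
... | right Γ₂↭ s′ x∉Γ₁ rewrite val-injective (subst-fresh w d₁ x∉Γ₁)
  with ⊢u′ , u′≤ ← subst-typed d₂ Γ₂↭ ⊢w =
  ty-pair d₁ ⊢u′ s′ , +-monoʳ-≤-offset (sizeᵛ v) (sizeᵛ w) u′≤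
subst-typed {x = x} {w = w} (ty-let {x = y} {y = z} {e = e} {f} y≢z y∉Γ₁ z∉Γ₁ d₁ d₂ s) Γ↭ ⊢w
  with locate s Γ↭
... | left {Γ₁′} Γ₁↭ s′ x∉Γ₂
  rewrite substBody-other {x} {w} {y} {z} {e} (∈∉⇒≢ (head∈dom Γ₁↭) y∉Γ₁) (∈∉⇒≢ (head∈dom Γ₁↭) z∉Γ₁)
        | subst-fresh w d₂ x∉Γ₂
  with ⊢e′ , e′≤ ← subst-typed d₁ (↭-trans (↭.prep _ (↭.prep _ Γ₁↭)) (shift _ (_ ∷ _ ∷ []) Γ₁′))
                                 ⊢w =
  ty-let y≢z (y∉Γ₁ ∘′ dom⁺ (tail⊆ Γ₁↭)) (z∉Γ₁ ∘′ dom⁺ (tail⊆ Γ₁↭)) ⊢e′ d₂ s′ ,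
  s≤s (+-monoʳ-≤-offset (size f) (sizeᵛ w) e′≤)
... | right Γ₂↭ s′ x∉Γ₁
  rewrite substBody-inert {x} {w} {y} {z} {e}
            (λ x≢y x≢z → subst-fresh w d₁ (∉-∷ x≢y (∉-∷ x≢z x∉Γ₁)))
  with ⊢f′ , f′≤ ← subst-typed d₂ Γ₂↭ ⊢w =
  ty-let y≢z y∉Γ₁ z∉Γ₁ d₁ ⊢f′ s′ , s≤s (+-monoˡ-≤-offset (size e) (sizeᵛ w) f′≤)
subst-typed {w = w} (ty-if {e = e} {f} {g} d₁ d₂ d₃ s) Γ↭ ⊢w with locate s Γ↭
... | left Γ₁↭ s′ x∉Γ₂ rewrite subst-fresh w d₂ x∉Γ₂ | subst-fresh w d₃ x∉Γ₂
  with ⊢e′ , e′≤ ← subst-typed d₁ Γ₁↭ ⊢w =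
  ty-if ⊢e′ d₂ d₃ s′ , s≤s (+-monoˡ-≤-offset (size f ⊔ size g) (sizeᵛ w) e′≤)
... | right Γ₂↭ s′ x∉Γ₁ rewrite subst-fresh w d₁ x∉Γ₁
  with ⊢f′ , f′≤ ← subst-typed d₂ Γ₂↭ ⊢w | ⊢g′ , g′≤ ← subst-typed d₃ Γ₂↭ ⊢w =
  ty-if d₁ ⊢f′ ⊢g′ s′ ,
  s≤s (+-monoʳ-≤-offset (size e) (sizeᵛ w) (⊔-mono-≤-offset (sizeᵛ w) f′≤ g′≤))
subst-typed {w = w} (ty-⊕ d₁ d₂) Γ↭ ⊢w
  with ⊢e′ , e′≤ ← subst-typed d₁ Γ↭ ⊢w | ⊢f′ , f′≤ ← subst-typed d₂ Γ↭ ⊢w =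
  ty-⊕ ⊢e′ ⊢f′ , s≤s (⊔-mono-≤-offset (sizeᵛ w) e′≤ f′≤)

-- Existence

choose : ∀ {A B : Set} {Q : A → Set} {P : A → B → Set} → Decidable Q → B →
         (∀ a → Q a → Σ B (P a)) → Σ (A → B) λ k → ∀ a → Q a → P a (k a)
choose {B = B} {Q} {P} Q? default pick = (λ a → k a (Q? a)) , (λ a qa → spec a (Q? a) qa)
  where
  k : ∀ a → Dec (Q a) → B
  k a (yes qa) = proj₁ (pick a qa)
  k a (no _)   = default
  spec : ∀ a (qa? : Dec (Q a)) → Q a → P a (k a qa?)
  spec a (yes qa) _  = proj₂ (pick a qa)
  spec a (no ¬qa) qa = ⊥-elim (¬qa qa)

lam-inv : ∀ {x s A B} → [] ⊢ val (lam x s) ∶ (A ⊸ B) → ((x , A) ∷ []) ⊢ s ∶ B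
lam-inv (ty-lam _ d) = d

pair-inv : ∀ {v w X Y} → [] ⊢ val (pair v w) ∶ (X ⊗ Y) → [] ⊢ val v ∶ X × [] ⊢ val w ∶ Y
pair-inv (ty-pair d₁ d₂ s) with refl , refl ← split-[]⁻ s = d₁ , d₂

TypedValue : Ty → ℕ → Val → Set
TypedValue A n v = [] ⊢ val v ∶ A × sizeᵛ v ≤ₙ n

Evaluation : Term → Ty → ℕ → Set
Evaluation e A n = Σ SubDist λ E → e ⇓ E × AllCharged (TypedValue A n) E

Evaluator : Ty → ℕ → Set
Evaluator A n = ∀ {t} → [] ⊢ t ∶ A → size t ≤ₙ n → Evaluation t A n

typedValue-weaken : ∀ {A m n v} → m ≤ₙ n → TypedValue A m v → TypedValue A n v
typedValue-weaken m≤n (⊢v , v≤m) = ⊢v , ℕₚ.≤-trans v≤m m≤n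

evaluation-weaken : ∀ {e A m n} → m ≤ₙ n → Evaluation e A m → Evaluation e A n
evaluation-weaken m≤n (E , e⇓E , E-ok) = E , e⇓E , AllCharged-map (typedValue-weaken m≤n) E-ok

evaluation-val : ∀ {v A} → [] ⊢ val v ∶ A → Evaluation (val v) A (sizeᵛ v)
evaluation-val {v} ⊢v =
  diracD v closed , ev-val (δ-same v) (λ _ → δ-other) , diracD-charged closed (⊢v , ℕₚ.≤-refl)
  where closed = typed-closed ⊢v

evaluation-Ω : ∀ {A n} → Evaluation Ω A n
evaluation-Ω = zeroD , ev-Ω (λ _ → refl) , zeroD-charged

evaluation-⊕ : ∀ {e f A m n} → Evaluation e A m → Evaluation f A n → Evaluation (e ⊕ f) A (m ⊔ n)
evaluation-⊕ {m = m} {n} (E , e⇓E , E-ok) (F , f⇓F , F-ok) =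
  mixD 0≤½ 0≤½ ½+½≤1 E F , ev-⊕ e⇓E f⇓F (λ _ → refl) ,
  mixD-charged 0≤½ 0≤½ ½+½≤1 (AllCharged-map (typedValue-weaken (ℕₚ.m≤m⊔n m n)) E-ok)
                             (AllCharged-map (typedValue-weaken (ℕₚ.m≤n⊔m m n)) F-ok)
  where
  0≤½ : 0ℚ ≤ ½
  0≤½ = ≤ᵇ⇒≤ _
  ½+½≤1 : ½ + ½ ≤ 1ℚ
  ½+½≤1 = ≤ᵇ⇒≤ _

tt+ff≤1 : ∀ E → mass E tt + mass E ff ≤ 1ℚ
tt+ff≤1 E = transport (_≤ 1ℚ) (cong (mass E tt +_) (+-identityʳ (mass E ff)))
                      (mass-bounded E (((λ ()) ∷ []) ∷ [] ∷ []))

evaluation-if : ∀ {c f g A l m n} → Evaluation c bool l → Evaluation f A m → Evaluation g A n →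
                Evaluation (ifte c f g) A (m ⊔ n)
evaluation-if {m = m} {n} (C , c⇓C , _) (F , f⇓F , F-ok) (G , g⇓G , G-ok) =
  mixD 0≤Ctt 0≤Cff (tt+ff≤1 C) F G , ev-if c⇓C f⇓F g⇓G (λ _ → refl) ,
  mixD-charged 0≤Ctt 0≤Cff (tt+ff≤1 C) (AllCharged-map (typedValue-weaken (ℕₚ.m≤m⊔n m n)) F-ok)
                                       (AllCharged-map (typedValue-weaken (ℕₚ.m≤n⊔m m n)) G-ok)
  where
  0≤Ctt = mass-nonneg C tt
  0≤Cff = mass-nonneg C ff

evaluation-app : ∀ {e f A B m n} → Evaluation e (A ⊸ B) m → Evaluation f A n →
                 Evaluator B (m +ₙ n) → Evaluation (app e f) B (m +ₙ n)
evaluation-app {B = B} {m = m} {n} (E , e⇓E , E-ok) (F , f⇓F , F-ok) evaluator =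
  bindD E (λ v → bindD F (onLam G v)) , ev-app G e⇓E f⇓F G⇓ (λ u → sym (appMass≡bindMass E F G u)) ,
  bindD-charged {E = E} λ v 0<Ev → bindD-charged {E = F} (onLam-charged v 0<Ev)
  where
  Redex = Var × Term × Val
  Charged : Redex → Set
  Charged (x , s , w) = 0ℚ < mass E (lam x s) × 0ℚ < mass F w
  reduce : ∀ r → Charged r → Evaluation (let x , s , w = r in subst s x w) B (m +ₙ n)
  reduce (x , s , w) (0<Eλ , 0<Fw) =
    let ⊢λ , s≤m = charged E-ok (lam x s) 0<Eλ
        ⊢w , w≤n = charged F-ok w 0<Fw
        ⊢t , t≤  = subst-typed (lam-inv ⊢λ) ↭.refl ⊢w
    in evaluator ⊢t (ℕₚ.≤-trans t≤ (ℕₚ.+-mono-≤ s≤m w≤n))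
  reductions = choose (λ (x , s , w) → (0ℚ <? mass E (lam x s)) ×-dec (0ℚ <? mass F w)) zeroD reduce
  G : Val → Val → SubDist
  G (lam x s) w = proj₁ reductions (x , s , w)
  G _         _ = zeroD
  G⇓ : ∀ x s w → 0ℚ < mass E (lam x s) → 0ℚ < mass F w → subst s x w ⇓ G (lam x s) w
  G⇓ x s w 0<Eλ 0<Fw = proj₁ (proj₂ reductions (x , s , w) (0<Eλ , 0<Fw))
  onLam-charged : ∀ v → 0ℚ < mass E v → ∀ w → 0ℚ < mass F w →
                  AllCharged (TypedValue B (m +ₙ n)) (onLam G v w)
  onLam-charged (lam x s) 0<Eλ w 0<Fw = proj₂ (proj₂ reductions (x , s , w) (0<Eλ , 0<Fw))
  onLam-charged (var _)    _ _ _ = zeroD-charged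
  onLam-charged tt         _ _ _ = zeroD-charged
  onLam-charged ff         _ _ _ = zeroD-charged
  onLam-charged (pair _ _) _ _ _ = zeroD-charged

evaluation-let : ∀ {f x y e X Y A n} → Evaluation f (X ⊗ Y) n → ((x , X) ∷ (y , Y) ∷ []) ⊢ e ∶ A →
                 Evaluator A (n +ₙ size e) → Evaluation (letp f x y e) A (n +ₙ size e)
evaluation-let {x = x} {y} {e} {A = A} {n} (E , f⇓E , E-ok) ⊢e evaluator =
  bindD E (onPair G) , ev-let G f⇓E G⇓ (λ u → sym (letMass≡bindMass E G u)) ,
  bindD-charged {E = E} onPair-charged
  where
  Charged : Val × Val → Set
  Charged (v , w) = 0ℚ < mass E (pair v w)
  reduce : ∀ r → Charged r → Evaluation (let v , w = r in subst (subst e x v) y w) A (n +ₙ size e)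
  reduce (v , w) 0<E =
    let ⊢vw , vw≤n = charged E-ok (pair v w) 0<E
        ⊢v , ⊢w    = pair-inv ⊢vw
        ⊢t₁ , t₁≤  = subst-typed ⊢e ↭.refl ⊢v
        ⊢t₂ , t₂≤  = subst-typed ⊢t₁ ↭.refl ⊢w
    in evaluator ⊢t₂ (ℕₚ.≤-trans t₂≤ (ℕₚ.≤-trans (ℕₚ.+-monoˡ-≤ (sizeᵛ w) t₁≤) (body≤ vw≤n)))
    where
    body≤ : sizeᵛ v +ₙ sizeᵛ w ≤ₙ n → size e +ₙ sizeᵛ v +ₙ sizeᵛ w ≤ₙ n +ₙ size e
    body≤ vw≤n = begin
      size e +ₙ sizeᵛ v +ₙ sizeᵛ w    ≡⟨ ℕₚ.+-assoc (size e) (sizeᵛ v) (sizeᵛ w) ⟩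
      size e +ₙ (sizeᵛ v +ₙ sizeᵛ w)  ≤⟨ ℕₚ.+-monoʳ-≤ (size e) vw≤n ⟩
      size e +ₙ n                     ≡⟨ ℕₚ.+-comm (size e) n ⟩
      n +ₙ size e                     ∎
      where open ℕₚ.≤-Reasoning
  reductions = choose (λ (v , w) → 0ℚ <? mass E (pair v w)) zeroD reduce
  G : Val → Val → SubDist
  G v w = proj₁ reductions (v , w)
  G⇓ : ∀ v w → 0ℚ < mass E (pair v w) → subst (subst e x v) y w ⇓ G v w
  G⇓ v w 0<E = proj₁ (proj₂ reductions (v , w) 0<E)
  onPair-charged : ∀ p → 0ℚ < mass E p → AllCharged (TypedValue A (n +ₙ size e)) (onPair G p)
  onPair-charged (pair v w) 0<E = proj₂ (proj₂ reductions (v , w) 0<E)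
  onPair-charged (var _)    _ = zeroD-charged
  onPair-charged tt         _ = zeroD-charged
  onPair-charged ff         _ = zeroD-charged
  onPair-charged (lam _ _)  _ = zeroD-charged

mutual
  evaluate : ∀ k {t A} → [] ⊢ t ∶ A → size t <ₙ k → Evaluation t A (size t)
  evaluate zero    _                  ()
  evaluate (suc k) ⊢t@ty-tt           _ = evaluation-val ⊢t
  evaluate (suc k) ⊢t@ty-ff           _ = evaluation-val ⊢t
  evaluate (suc k) ⊢t@(ty-lam _ _)    _ = evaluation-val ⊢t
  evaluate (suc k) ⊢t@(ty-pair _ _ _) _ = evaluation-val ⊢t
  evaluate (suc k) (ty-Ω _)           _ = evaluation-Ω
  evaluate (suc k) (ty-⊕ d₁ d₂) (s≤s t<k) =
    evaluation-weaken (ℕₚ.n≤1+n _)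
      (evaluation-⊕ (evaluate k d₁ (ℕₚ.≤-<-trans (ℕₚ.m≤m⊔n _ _) t<k))
                    (evaluate k d₂ (ℕₚ.≤-<-trans (ℕₚ.m≤n⊔m _ _) t<k)))
  evaluate (suc k) (ty-if {e = c} {f} {g} d₁ d₂ d₃ s) (s≤s t<k) with refl , refl ← split-[]⁻ s =
    evaluation-weaken (ℕₚ.≤-trans (ℕₚ.m≤n+m _ (size c)) (ℕₚ.n≤1+n _))
      (evaluation-if (evaluate k d₁ (ℕₚ.≤-<-trans (ℕₚ.m≤m+n _ _) t<k))
                     (evaluate k d₂ (branch< (ℕₚ.m≤m⊔n _ _)))
                     (evaluate k d₃ (branch< (ℕₚ.m≤n⊔m _ _))))
    where
    branch< : ∀ {b} → b ≤ₙ size f ⊔ size g → b <ₙ k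
    branch< b≤ = ℕₚ.≤-<-trans (ℕₚ.≤-trans b≤ (ℕₚ.m≤n+m _ (size c))) t<k
  evaluate (suc k) (ty-app d₁ d₂ s) (s≤s t<k) with refl , refl ← split-[]⁻ s =
    evaluation-weaken (ℕₚ.n≤1+n _)
      (evaluation-app (evaluate k d₁ (ℕₚ.≤-<-trans (ℕₚ.m≤m+n _ _) t<k))
                      (evaluate k d₂ (ℕₚ.≤-<-trans (ℕₚ.m≤n+m _ _) t<k))
                      (evaluator t<k))
  evaluate (suc k) (ty-let _ _ _ d₁ d₂ s) (s≤s t<k) with refl , refl ← split-[]⁻ s =
    evaluation-weaken (ℕₚ.n≤1+n _)
      (evaluation-let (evaluate k d₂ (ℕₚ.≤-<-trans (ℕₚ.m≤m+n _ _) t<k)) d₁ (evaluator t<k))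

  evaluator : ∀ {k A n} → n <ₙ k → Evaluator A n
  evaluator {k} n<k ⊢t t≤n = evaluation-weaken t≤n (evaluate k ⊢t (ℕₚ.≤-<-trans t≤n n<k))

mainTheorem1 : (A : Ty) (e : Term) → [] ⊢ e ∶ A →
    Σ SubDist (λ E → (OfType A E × e ⇓ E) ×
    ((F : SubDist) → OfType A F → e ⇓ F → F ≈D E))
mainTheorem1 A e ⊢e =
  let E , e⇓E , E-typed = evaluate (suc (size e)) ⊢e (ℕₚ.n<1+n (size e))
  in E , ((λ v 0<Ev → proj₁ (charged E-typed v 0<Ev)) , e⇓E) , λ F _ e⇓F → ⇓-deterministic e⇓F e⇓E
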